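{- For all integers $a,b\geq 1$ there exists a shiftable $SMR(4b,2b(4a+2);4a+2,2)$.
   Context: A signed magic rectangle $SMR(m,n;r,s)$ is an $m\times n$ array, some of whose cells are filled with integers and the others empty, such that exactly $r$ cells in every row and exactly $s$ cells in every column are filled (so $mr=ns$), every element of $X$ appears exactly once in the array, and the sum of the entries of each row and of each column is zero, where (for $mr$ even) $X=\{\pm1,\pm2,\ldots,\pm mr/2\}$. An array is shiftable if every row and every column contains the same number of positive entries as negative entries. -}

module Defs where

open import Data.Nat as ℕ using (ℕ; zero; suc)
open import Data.Integer as ℤ using (ℤ; +_; -[1+_]; 0ℤ)
open import Data.Fin using (Fin; zero; suc)
open import Data.Maybe using (Maybe; just; nothing)
open import Data.Product using (_×_; Σ; _,_)
open import Data.Bool using (Bool; true; false)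
open import Relation.Binary.PropositionalEquality using (_≡_)
open import Relation.Nullary using (¬_)

-- A partially filled m × n array of integers: nothing = empty cell.
PArray : ℕ → ℕ → Set
PArray m n = Fin m → Fin n → Maybe ℤ

count : ∀ {n} → (Fin n → Bool) → ℕ
count {zero} p = 0
count {suc n} p with p zero
... | true  = suc (count (λ i → p (suc i)))
... | false = count (λ i → p (suc i))

sumℤ : ∀ {n} → (Fin n → ℤ) → ℤ
sumℤ {zero} f = 0ℤ
sumℤ {suc n} f = f zero ℤ.+ sumℤ (λ i → f (suc i))

filled? : Maybe ℤ → Bool
filled? (just _) = true
filled? nothing  = false

positive? : Maybe ℤ → Bool
positive? (just (+ suc _)) = true
positive? _                = false

negative? : Maybe ℤ → Bool
negative? (just -[1+ _ ]) = true
negative? _               = false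

val : Maybe ℤ → ℤ
val (just x) = x
val nothing  = 0ℤ

InX : ℕ → ℤ → Set
InX k x = (¬ (x ≡ 0ℤ)) × (ℤ.∣ x ∣ ℕ.≤ k)

-- SMR(m,n;r,s) with X = {±1,…,±(m r / 2)} (used with m r even).
record IsSMR (m n r s : ℕ) (A : PArray m n) : Set where
  field
    rowFilled : ∀ i → count (λ j → filled? (A i j)) ≡ r
    colFilled : ∀ j → count (λ i → filled? (A i j)) ≡ s
    entriesInX : ∀ i j x → A i j ≡ just x → InX (m ℕ.* r ℕ./ 2) x
    appearsOnce : ∀ x → InX (m ℕ.* r ℕ./ 2) x →
      Σ (Fin m) λ i → Σ (Fin n) λ j → (A i j ≡ just x) ×
        (∀ i' j' → A i' j' ≡ just x → (i' ≡ i) × (j' ≡ j))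
    rowSum : ∀ i → sumℤ (λ j → val (A i j)) ≡ 0ℤ
    colSum : ∀ j → sumℤ (λ i → val (A i j)) ≡ 0ℤ

record IsShiftable {m n : ℕ} (A : PArray m n) : Set where
  field
    rowBalanced : ∀ i → count (λ j → positive? (A i j)) ≡ count (λ j → negative? (A i j))
    colBalanced : ∀ j → count (λ i → positive? (A i j)) ≡ count (λ i → negative? (A i j))

-- Label each column v < N by a row P v and put v + 1 into row P v and −(v + 1) into its
-- partner row (rows are paired 2j ↔ 2j + 1). Every column is then zero-sum and shiftable and
-- every value ±1, …, ±N occurs exactly once, so it suffices to find a labelling in which each
-- row receives c positive and c negative entries with zero sum. Such balanced labellings of
-- the same rows can be concatenated, because shifting a block's columns by m changes each row
-- sum by m · (#positive − #negative) = 0. For a = k + 1, rows 0–3 are served by k copies of an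
-- 8-column block adding two positive and two negative entries to every row, followed by a
-- 12-column base block with three of each; b copies of this block on disjoint quadruples of
-- rows give the 4b × 2b(4a + 2) array.

module Submission where

open import Defs
open import Data.Bool using (Bool; true; false; T; if_then_else_; _∧_; _∨_)
open import Data.Empty using (⊥-elim)
open import Data.Fin using (Fin; toℕ; fromℕ<)
import Data.Fin.Properties as Finₚ
open import Data.Integer as ℤ using (ℤ; +_; -[1+_]; 0ℤ; 1ℤ; -1ℤ)
import Data.Integer.Properties as ℤₚ
open import Data.Integer.Tactic.RingSolver using (solve-∀)
open import Data.List using (List; []; _∷_; length)
open import Data.List.Relation.Unary.All using (All; []; _∷_; all?)
open import Data.Maybe using (Maybe; just; nothing)
open import Data.Nat as ℕ
  using (ℕ; zero; suc; _+_; _*_; _∸_; _≤_; _<_; _≥_; z≤n; s≤s; _≡ᵇ_; _<ᵇ_; _<?_)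
import Data.Nat.Properties as ℕₚ
open import Data.Nat.DivMod using (m*n/n≡m)
open import Data.Nat.Tactic.RingSolver using () renaming (solve-∀ to solve-∀ℕ)
open import Data.Product using (Σ; _×_; _,_)
open import Data.Sum using (_⊎_; inj₁; inj₂)
open import Function using (_∘_; id)
open import Relation.Binary.PropositionalEquality
open import Relation.Nullary using (yes; no)
open import Relation.Nullary.Decidable using (toWitness)

countBelow : (ℕ → Bool) → ℕ → ℕ
countBelow f zero    = 0
countBelow f (suc n) =
  if f 0 then suc (countBelow (f ∘ suc) n) else countBelow (f ∘ suc) n

sumBelow : (ℕ → ℤ) → ℕ → ℤ
sumBelow f zero    = 0ℤ
sumBelow f (suc n) = f 0 ℤ.+ sumBelow (f ∘ suc) n

count-toℕ : ∀ n (f : ℕ → Bool) → count {n} (f ∘ toℕ) ≡ countBelow f n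
count-toℕ zero    f = refl
count-toℕ (suc n) f with f 0
... | true  = cong suc (count-toℕ n (f ∘ suc))
... | false = count-toℕ n (f ∘ suc)

sumℤ-toℕ : ∀ n (f : ℕ → ℤ) → sumℤ {n} (f ∘ toℕ) ≡ sumBelow f n
sumℤ-toℕ zero    f = refl
sumℤ-toℕ (suc n) f = cong (λ s → f 0 ℤ.+ s) (sumℤ-toℕ n (f ∘ suc))

countBelow-+ : ∀ f m n → countBelow f (m + n) ≡ countBelow f m + countBelow (λ v → f (m + v)) n
countBelow-+ f zero    n = refl
countBelow-+ f (suc m) n with f 0
... | true  = cong suc (countBelow-+ (f ∘ suc) m n)
... | false = countBelow-+ (f ∘ suc) m n

sumBelow-+ : ∀ f m n → sumBelow f (m + n) ≡ sumBelow f m ℤ.+ sumBelow (λ v → f (m + v)) n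
sumBelow-+ f zero    n = sym (ℤₚ.+-identityˡ _)
sumBelow-+ f (suc m) n = trans (cong (λ s → f 0 ℤ.+ s) (sumBelow-+ (f ∘ suc) m n))
                               (sym (ℤₚ.+-assoc (f 0) _ _))

countBelow-cong : ∀ {f g} n → (∀ v → v < n → f v ≡ g v) → countBelow f n ≡ countBelow g n
countBelow-cong zero    f≗g = refl
countBelow-cong {f} {g} (suc n) f≗g with f 0 | g 0 | f≗g 0 (s≤s z≤n)
... | true  | .true  | refl = cong suc (countBelow-cong n (λ v v<n → f≗g (suc v) (s≤s v<n)))
... | false | .false | refl = countBelow-cong n (λ v v<n → f≗g (suc v) (s≤s v<n))

sumBelow-cong : ∀ {f g} n → (∀ v → v < n → f v ≡ g v) → sumBelow f n ≡ sumBelow g n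
sumBelow-cong zero    f≗g = refl
sumBelow-cong (suc n) f≗g =
  cong₂ ℤ._+_ (f≗g 0 (s≤s z≤n)) (sumBelow-cong n (λ v v<n → f≗g (suc v) (s≤s v<n)))

countBelow-false : ∀ n → countBelow (λ _ → false) n ≡ 0
countBelow-false zero    = refl
countBelow-false (suc n) = countBelow-false n

sumBelow-0 : ∀ n → sumBelow (λ _ → 0ℤ) n ≡ 0ℤ
sumBelow-0 zero    = refl
sumBelow-0 (suc n) = trans (ℤₚ.+-identityˡ _) (sumBelow-0 n)

sumBelow-distrib-+ : ∀ f g n →
  sumBelow (λ v → f v ℤ.+ g v) n ≡ sumBelow f n ℤ.+ sumBelow g n
sumBelow-distrib-+ f g zero    = refl
sumBelow-distrib-+ f g (suc n) =
  trans (cong (λ s → f 0 ℤ.+ g 0 ℤ.+ s) (sumBelow-distrib-+ (f ∘ suc) (g ∘ suc) n))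
        (interchange (f 0) (g 0) _ _)
  where
  interchange : ∀ a b c d → (a ℤ.+ b) ℤ.+ (c ℤ.+ d) ≡ (a ℤ.+ c) ℤ.+ (b ℤ.+ d)
  interchange = solve-∀

sumBelow-*ʳ : ∀ f x n → sumBelow (λ v → f v ℤ.* x) n ≡ sumBelow f n ℤ.* x
sumBelow-*ʳ f x zero    = refl
sumBelow-*ʳ f x (suc n) =
  trans (cong (λ s → f 0 ℤ.* x ℤ.+ s) (sumBelow-*ʳ (f ∘ suc) x n))
        (sym (ℤₚ.*-distribʳ-+ x (f 0) _))

countBelow-∨ : ∀ f g n → (∀ v → f v ∧ g v ≡ false) →
  countBelow (λ v → f v ∨ g v) n ≡ countBelow f n + countBelow g n
countBelow-∨ f g zero    disjoint = refl
countBelow-∨ f g (suc n) disjoint with f 0 | g 0 | disjoint 0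
... | true  | false | _ = cong suc (countBelow-∨ (f ∘ suc) (g ∘ suc) n (disjoint ∘ suc))
... | false | true  | _ = trans (cong suc (countBelow-∨ (f ∘ suc) (g ∘ suc) n (disjoint ∘ suc)))
                               (sym (ℕₚ.+-suc _ _))
... | false | false | _ = countBelow-∨ (f ∘ suc) (g ∘ suc) n (disjoint ∘ suc)

countBelow-≡ᵇ : ∀ {p} n → p < n → countBelow (p ≡ᵇ_) n ≡ 1
countBelow-≡ᵇ {zero}  (suc n) _         = cong suc (countBelow-false n)
countBelow-≡ᵇ {suc p} (suc n) (s≤s p<n) = countBelow-≡ᵇ n p<n

signOf : Bool → Bool → ℤ
signOf true  _     = 1ℤ
signOf false true  = -1ℤ
signOf false false = 0ℤ

sumBelow-signOf : ∀ f g n → (∀ v → f v ∧ g v ≡ false) →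
  sumBelow (λ v → signOf (f v) (g v)) n ≡ + countBelow f n ℤ.- + countBelow g n
sumBelow-signOf f g zero    disjoint = refl
sumBelow-signOf f g (suc n) disjoint
  with f 0 | g 0 | disjoint 0 | sumBelow-signOf (f ∘ suc) (g ∘ suc) n (disjoint ∘ suc)
... | true  | false | _ | ih =
  trans (cong (λ s → 1ℤ ℤ.+ s) ih)
        (sym (ℤₚ.+-assoc 1ℤ (+ countBelow (f ∘ suc) n) (ℤ.- + countBelow (g ∘ suc) n)))
... | false | true  | _ | ih =
  trans (cong (λ s → -1ℤ ℤ.+ s) ih)
        (-1+[x-y]≡x-[1+y] (+ countBelow (f ∘ suc) n) (+ countBelow (g ∘ suc) n))
  where
  -1+[x-y]≡x-[1+y] : ∀ x y → -1ℤ ℤ.+ (x ℤ.- y) ≡ x ℤ.- (1ℤ ℤ.+ y)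
  -1+[x-y]≡x-[1+y] = solve-∀
... | false | false | _ | ih = trans (ℤₚ.+-identityˡ _) ih

partner : ℕ → ℕ
partner zero                = 1
partner (suc zero)          = 0
partner (suc (suc i))       = suc (suc (partner i))

partner-involutive : ∀ i → partner (partner i) ≡ i
partner-involutive zero          = refl
partner-involutive (suc zero)    = refl
partner-involutive (suc (suc i)) = cong (suc ∘ suc) (partner-involutive i)

partner-< : ∀ h i → i < h * 2 → partner i < h * 2
partner-< (suc h) zero          _                 = s≤s (s≤s z≤n)
partner-< (suc h) (suc zero)    _                 = s≤s z≤n
partner-< (suc h) (suc (suc i)) (s≤s (s≤s i<2h)) = s≤s (s≤s (partner-< h i i<2h))

≡ᵇ-partner : ∀ p i → (p ≡ᵇ partner i) ≡ (partner p ≡ᵇ i)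
≡ᵇ-partner zero          zero          = refl
≡ᵇ-partner zero          (suc zero)    = refl
≡ᵇ-partner zero          (suc (suc i)) = refl
≡ᵇ-partner (suc zero)    zero          = refl
≡ᵇ-partner (suc zero)    (suc zero)    = refl
≡ᵇ-partner (suc zero)    (suc (suc i)) = refl
≡ᵇ-partner (suc (suc p)) zero          = refl
≡ᵇ-partner (suc (suc p)) (suc zero)    = refl
≡ᵇ-partner (suc (suc p)) (suc (suc i)) = ≡ᵇ-partner p i

countBelow-partner : ∀ {p} M → partner p < M → countBelow (λ r → p ≡ᵇ partner r) M ≡ 1
countBelow-partner {p} M p′<M =
  trans (countBelow-cong M (λ r _ → ≡ᵇ-partner p r)) (countBelow-≡ᵇ M p′<M)

≡ᵇ-partner-disjoint : ∀ p i → (p ≡ᵇ i) ∧ (p ≡ᵇ partner i) ≡ false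
≡ᵇ-partner-disjoint zero          zero          = refl
≡ᵇ-partner-disjoint zero          (suc zero)    = refl
≡ᵇ-partner-disjoint zero          (suc (suc i)) = refl
≡ᵇ-partner-disjoint (suc zero)    zero          = refl
≡ᵇ-partner-disjoint (suc zero)    (suc zero)    = refl
≡ᵇ-partner-disjoint (suc zero)    (suc (suc i)) = refl
≡ᵇ-partner-disjoint (suc (suc p)) zero          = refl
≡ᵇ-partner-disjoint (suc (suc p)) (suc zero)    = refl
≡ᵇ-partner-disjoint (suc (suc p)) (suc (suc i)) = ≡ᵇ-partner-disjoint p i

≡ᵇ-refl : ∀ p → (p ≡ᵇ p) ≡ true
≡ᵇ-refl zero    = refl
≡ᵇ-refl (suc p) = ≡ᵇ-refl p

≡ᵇ-partner-self : ∀ p → (p ≡ᵇ partner p) ≡ false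
≡ᵇ-partner-self zero          = refl
≡ᵇ-partner-self (suc zero)    = refl
≡ᵇ-partner-self (suc (suc p)) = ≡ᵇ-partner-self p

≢⇒≡ᵇ-false : ∀ {x y} → x ≢ y → (x ≡ᵇ y) ≡ false
≢⇒≡ᵇ-false {x} {y} x≢y with x ≡ᵇ y in eq
... | true  = ⊥-elim (x≢y (ℕₚ.≡ᵇ⇒≡ x y (subst T (sym eq) _)))
... | false = refl

signedCell : Bool → Bool → ℕ → Maybe ℤ
signedCell true  _     v = just (+ suc v)
signedCell false true  v = just -[1+ v ]
signedCell false false v = nothing

filled?-signedCell : ∀ x y v → filled? (signedCell x y v) ≡ x ∨ y
filled?-signedCell true  _     v = refl
filled?-signedCell false true  v = refl
filled?-signedCell false false v = refl

positive?-signedCell : ∀ x y v → positive? (signedCell x y v) ≡ x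
positive?-signedCell true  _     v = refl
positive?-signedCell false true  v = refl
positive?-signedCell false false v = refl

negative?-signedCell : ∀ x y v → x ∧ y ≡ false → negative? (signedCell x y v) ≡ y
negative?-signedCell true  false v _ = refl
negative?-signedCell false true  v _ = refl
negative?-signedCell false false v _ = refl

val-signedCell : ∀ x y v → val (signedCell x y v) ≡ signOf x y ℤ.* + suc v
val-signedCell true  _     v = sym (ℤₚ.*-identityˡ _)
val-signedCell false true  v = sym (ℤₚ.-1*i≡-i _)
val-signedCell false false v = refl

signedCell-just : ∀ x y v {z} → signedCell x y v ≡ just z →
  (T x × z ≡ + suc v) ⊎ (T y × z ≡ -[1+ v ])
signedCell-just true  _     v refl = inj₁ (_ , refl)
signedCell-just false true  v refl = inj₂ (_ , refl)

sign : ℕ → ℕ → ℤ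
sign p i = signOf (p ≡ᵇ i) (p ≡ᵇ partner i)

cell : ℕ → ℕ → ℕ → Maybe ℤ
cell p i v = signedCell (p ≡ᵇ i) (p ≡ᵇ partner i) v

countBelow-positive?-cell : ∀ (p i w : ℕ → ℕ) n →
  countBelow (λ v → positive? (cell (p v) (i v) (w v))) n ≡ countBelow (λ v → p v ≡ᵇ i v) n
countBelow-positive?-cell p i w n =
  countBelow-cong n (λ v _ → positive?-signedCell (p v ≡ᵇ i v) (p v ≡ᵇ partner (i v)) (w v))

countBelow-negative?-cell : ∀ (p i w : ℕ → ℕ) n →
  countBelow (λ v → negative? (cell (p v) (i v) (w v))) n ≡
  countBelow (λ v → p v ≡ᵇ partner (i v)) n
countBelow-negative?-cell p i w n = countBelow-cong n (λ v _ →
  negative?-signedCell (p v ≡ᵇ i v) (p v ≡ᵇ partner (i v)) (w v)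
                       (≡ᵇ-partner-disjoint (p v) (i v)))

countBelow-filled?-cell : ∀ (p i w : ℕ → ℕ) n →
  countBelow (λ v → filled? (cell (p v) (i v) (w v))) n ≡
  countBelow (λ v → p v ≡ᵇ i v) n + countBelow (λ v → p v ≡ᵇ partner (i v)) n
countBelow-filled?-cell p i w n = trans
  (countBelow-cong n (λ v _ → filled?-signedCell (p v ≡ᵇ i v) (p v ≡ᵇ partner (i v)) (w v)))
  (countBelow-∨ _ _ n (λ v → ≡ᵇ-partner-disjoint (p v) (i v)))

sumBelow-val-cell : ∀ (p i w : ℕ → ℕ) n →
  sumBelow (λ v → val (cell (p v) (i v) (w v))) n ≡
  sumBelow (λ v → sign (p v) (i v) ℤ.* + suc (w v)) n
sumBelow-val-cell p i w n =
  sumBelow-cong n (λ v _ → val-signedCell (p v ≡ᵇ i v) (p v ≡ᵇ partner (i v)) (w v))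

cell-positive : ∀ p v → cell p p v ≡ just (+ suc v)
cell-positive p v rewrite ≡ᵇ-refl p = refl

cell-negative : ∀ p v → cell p (partner p) v ≡ just -[1+ v ]
cell-negative p v rewrite ≡ᵇ-partner-self p | partner-involutive p | ≡ᵇ-refl p = refl

cell-just-positive : ∀ p r w {v} → cell p r w ≡ just (+ suc v) → r ≡ p × w ≡ v
cell-just-positive p r w e with signedCell-just (p ≡ᵇ r) (p ≡ᵇ partner r) w e
... | inj₁ (p≡ᵇr , sv≡sw) =
  sym (ℕₚ.≡ᵇ⇒≡ p r p≡ᵇr) , sym (ℕₚ.suc-injective (ℤₚ.+-injective sv≡sw))
... | inj₂ (_ , ())

cell-just-negative : ∀ p r w {v} → cell p r w ≡ just -[1+ v ] → r ≡ partner p × w ≡ v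
cell-just-negative p r w e with signedCell-just (p ≡ᵇ r) (p ≡ᵇ partner r) w e
... | inj₁ (_ , ())
... | inj₂ (p≡ᵇr′ , v≡w) =
  trans (sym (partner-involutive r)) (cong partner (sym (ℕₚ.≡ᵇ⇒≡ p (partner r) p≡ᵇr′))) ,
  sym (ℤₚ.-[1+-injective v≡w)

record Balanced (P : ℕ → ℕ) (i n c : ℕ) : Set where
  field
    positives : countBelow (λ v → P v ≡ᵇ i) n ≡ c
    negatives : countBelow (λ v → P v ≡ᵇ partner i) n ≡ c
    signedSum : sumBelow (λ v → sign (P v) i ℤ.* + suc v) n ≡ 0ℤ
open Balanced

Balanced⇒sumBelow-sign : ∀ {P i n c} → Balanced P i n c →
  sumBelow (λ v → sign (P v) i) n ≡ 0ℤ
Balanced⇒sumBelow-sign {P} {i} {n} {c} bal = begin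
  sumBelow (λ v → sign (P v) i) n
    ≡⟨ sumBelow-signOf _ _ n (λ v → ≡ᵇ-partner-disjoint (P v) i) ⟩
  + countBelow (λ v → P v ≡ᵇ i) n ℤ.- + countBelow (λ v → P v ≡ᵇ partner i) n
    ≡⟨ cong₂ (λ a b → + a ℤ.- + b) (positives bal) (negatives bal) ⟩
  + c ℤ.- + c
    ≡⟨ ℤₚ.+-inverseʳ (+ c) ⟩
  0ℤ ∎
  where open ≡-Reasoning

Balanced-++ : ∀ {P i c d} m n → Balanced P i m c → Balanced (λ v → P (m + v)) i n d →
  Balanced P i (m + n) (c + d)
Balanced-++ {P} {i} m n front back = record
  { positives = trans (countBelow-+ _ m n) (cong₂ _+_ (positives front) (positives back))
  ; negatives = trans (countBelow-+ _ m n) (cong₂ _+_ (negatives front) (negatives back))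
  ; signedSum = trans (sumBelow-+ _ m n) (cong₂ ℤ._+_ (signedSum front) shiftedSum)
  }
  where
  s : ℕ → ℤ
  s v = sign (P (m + v)) i
  +suc[m+v] : ∀ v → + suc (m + v) ≡ + m ℤ.+ + suc v
  +suc[m+v] v = trans (cong +_ (sym (ℕₚ.+-suc m v))) (ℤₚ.pos-+ m (suc v))
  shiftedSum : sumBelow (λ v → s v ℤ.* + suc (m + v)) n ≡ 0ℤ
  shiftedSum = begin
    sumBelow (λ v → s v ℤ.* + suc (m + v)) n
      ≡⟨ sumBelow-cong n (λ v _ → cong (s v ℤ.*_) (+suc[m+v] v)) ⟩
    sumBelow (λ v → s v ℤ.* (+ m ℤ.+ + suc v)) n
      ≡⟨ sumBelow-cong n (λ v _ → ℤₚ.*-distribˡ-+ (s v) (+ m) (+ suc v)) ⟩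
    sumBelow (λ v → s v ℤ.* + m ℤ.+ s v ℤ.* + suc v) n
      ≡⟨ sumBelow-distrib-+ _ _ n ⟩
    sumBelow (λ v → s v ℤ.* + m) n ℤ.+ sumBelow (λ v → s v ℤ.* + suc v) n
      ≡⟨ cong₂ ℤ._+_ (sumBelow-*ʳ s (+ m) n) (signedSum back) ⟩
    sumBelow s n ℤ.* + m ℤ.+ 0ℤ
      ≡⟨ cong (λ t → t ℤ.* + m ℤ.+ 0ℤ) (Balanced⇒sumBelow-sign back) ⟩
    0ℤ ∎
    where open ≡-Reasoning

Balanced-cong : ∀ {P Q i n c} → (∀ v → v < n → P v ≡ Q v) →
  Balanced Q i n c → Balanced P i n c
Balanced-cong {i = i} {n} P≗Q bal = record
  { positives = trans (countBelow-cong n (λ v v<n → cong (_≡ᵇ i) (P≗Q v v<n))) (positives bal)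
  ; negatives = trans (countBelow-cong n (λ v v<n → cong (_≡ᵇ partner i) (P≗Q v v<n)))
                      (negatives bal)
  ; signedSum = trans (sumBelow-cong n (λ v v<n → cong (λ p → sign p i ℤ.* + suc v) (P≗Q v v<n)))
                      (signedSum bal)
  }

Balanced-absent : ∀ {P i n} → (∀ v → v < n → P v ≢ i) → (∀ v → v < n → P v ≢ partner i) →
  Balanced P i n 0
Balanced-absent {P} {i} {n} P≢i P≢i′ = record
  { positives = trans (countBelow-cong n (λ v v<n → ≢⇒≡ᵇ-false (P≢i v v<n))) (countBelow-false n)
  ; negatives = trans (countBelow-cong n (λ v v<n → ≢⇒≡ᵇ-false (P≢i′ v v<n))) (countBelow-false n)
  ; signedSum = trans (sumBelow-cong n vanishes) (sumBelow-0 n)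
  }
  where
  vanishes : ∀ v → v < n → sign (P v) i ℤ.* + suc v ≡ 0ℤ
  vanishes v v<n rewrite ≢⇒≡ᵇ-false (P≢i v v<n) | ≢⇒≡ᵇ-false (P≢i′ v v<n) = refl

Balanced-+2 : ∀ {P i n c} → Balanced P i n c → Balanced (suc ∘ suc ∘ P) (suc (suc i)) n c
Balanced-+2 bal = record
  { positives = positives bal ; negatives = negatives bal ; signedSum = signedSum bal }

LabelsBelow : ℕ → (ℕ → ℕ) → ℕ → Set
LabelsBelow M P n = ∀ v → v < n → P v < M

OccursOnce : ∀ {M N} → PArray M N → ℤ → Set
OccursOnce {M} {N} A x =
  Σ (Fin M) λ i → Σ (Fin N) λ j →
    (A i j ≡ just x) × (∀ i′ j′ → A i′ j′ ≡ just x → (i′ ≡ i) × (j′ ≡ j))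

labelArray : ∀ {M N} → (ℕ → ℕ) → PArray M N
labelArray P i j = cell (P (toℕ j)) (toℕ i) (toℕ j)

module _ {M N : ℕ} (P : ℕ → ℕ) where

  labelArray-rowPositives : ∀ {c} (i : Fin M) → Balanced P (toℕ i) N c →
    count (λ j → positive? (labelArray {M} {N} P i j)) ≡ c
  labelArray-rowPositives i bal =
    trans (count-toℕ N _) (trans (countBelow-positive?-cell P (λ _ → toℕ i) id N) (positives bal))

  labelArray-rowNegatives : ∀ {c} (i : Fin M) → Balanced P (toℕ i) N c →
    count (λ j → negative? (labelArray {M} {N} P i j)) ≡ c
  labelArray-rowNegatives i bal =
    trans (count-toℕ N _) (trans (countBelow-negative?-cell P (λ _ → toℕ i) id N) (negatives bal))

  labelArray-rowFilled : ∀ {c} (i : Fin M) → Balanced P (toℕ i) N c →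
    count (λ j → filled? (labelArray {M} {N} P i j)) ≡ c + c
  labelArray-rowFilled i bal = trans (count-toℕ N _) (trans
    (countBelow-filled?-cell P (λ _ → toℕ i) id N) (cong₂ _+_ (positives bal) (negatives bal)))

  labelArray-rowSum : ∀ {c} (i : Fin M) → Balanced P (toℕ i) N c →
    sumℤ (λ j → val (labelArray {M} {N} P i j)) ≡ 0ℤ
  labelArray-rowSum i bal =
    trans (sumℤ-toℕ N _) (trans (sumBelow-val-cell P (λ _ → toℕ i) id N) (signedSum bal))

  labelArray-colPositives : (j : Fin N) → P (toℕ j) < M →
    count (λ i → positive? (labelArray {M} {N} P i j)) ≡ 1
  labelArray-colPositives j p<M = trans (count-toℕ M _)
    (trans (countBelow-positive?-cell (λ _ → P (toℕ j)) id (λ _ → toℕ j) M)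
           (countBelow-≡ᵇ M p<M))

  labelArray-colNegatives : (j : Fin N) → partner (P (toℕ j)) < M →
    count (λ i → negative? (labelArray {M} {N} P i j)) ≡ 1
  labelArray-colNegatives j p′<M = trans (count-toℕ M _)
    (trans (countBelow-negative?-cell (λ _ → P (toℕ j)) id (λ _ → toℕ j) M)
           (countBelow-partner M p′<M))

  labelArray-colFilled : (j : Fin N) → P (toℕ j) < M → partner (P (toℕ j)) < M →
    count (λ i → filled? (labelArray {M} {N} P i j)) ≡ 2
  labelArray-colFilled j p<M p′<M = trans (count-toℕ M _) (trans
    (countBelow-filled?-cell (λ _ → P (toℕ j)) id (λ _ → toℕ j) M)
    (cong₂ _+_ (countBelow-≡ᵇ M p<M) (countBelow-partner M p′<M)))

  labelArray-colSum : (j : Fin N) → P (toℕ j) < M → partner (P (toℕ j)) < M →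
    sumℤ (λ i → val (labelArray {M} {N} P i j)) ≡ 0ℤ
  labelArray-colSum j p<M p′<M = begin
    sumℤ (λ i → val (labelArray {M} {N} P i j))
      ≡⟨ sumℤ-toℕ M _ ⟩
    sumBelow (λ r → val (cell p r v)) M
      ≡⟨ sumBelow-val-cell (λ _ → p) id (λ _ → v) M ⟩
    sumBelow (λ r → sign p r ℤ.* + suc v) M
      ≡⟨ sumBelow-*ʳ (sign p) (+ suc v) M ⟩
    sumBelow (sign p) M ℤ.* + suc v
      ≡⟨ cong (ℤ._* + suc v) (sumBelow-signOf _ _ M (≡ᵇ-partner-disjoint p)) ⟩
    (+ countBelow (p ≡ᵇ_) M ℤ.- + countBelow (λ r → p ≡ᵇ partner r) M) ℤ.* + suc v
      ≡⟨ cong₂ (λ a b → (+ a ℤ.- + b) ℤ.* + suc v)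
               (countBelow-≡ᵇ M p<M) (countBelow-partner M p′<M) ⟩
    0ℤ ∎
    where
    open ≡-Reasoning
    v = toℕ j
    p = P v

  labelArray-entriesInX : ∀ i j x → labelArray {M} {N} P i j ≡ just x → InX N x
  labelArray-entriesInX i j x e with signedCell-just _ _ (toℕ j) e
  ... | inj₁ (_ , refl) = (λ ()) , Finₚ.toℕ<n j
  ... | inj₂ (_ , refl) = (λ ()) , Finₚ.toℕ<n j

  labelArray-locate : ∀ {x r v} (r<M : r < M) (v<N : v < N) → cell (P v) r v ≡ just x →
    (∀ r′ w → cell (P w) r′ w ≡ just x → r′ ≡ r × w ≡ v) → OccursOnce (labelArray {M} {N} P) x
  labelArray-locate r<M v<N hit unique = fromℕ< r<M , fromℕ< v<N , hit′ , λ i′ j′ e →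
      let r′≡r , w≡v = unique (toℕ i′) (toℕ j′) e in
      Finₚ.toℕ-injective (trans r′≡r (sym (Finₚ.toℕ-fromℕ< r<M))) ,
      Finₚ.toℕ-injective (trans w≡v (sym (Finₚ.toℕ-fromℕ< v<N)))
    where
    hit′ : labelArray P (fromℕ< r<M) (fromℕ< v<N) ≡ just _
    hit′ rewrite Finₚ.toℕ-fromℕ< r<M | Finₚ.toℕ-fromℕ< v<N = hit

  labelArray-appearsOnce : (∀ r → r < M → partner r < M) → LabelsBelow M P N →
    ∀ x → InX N x → OccursOnce (labelArray {M} {N} P) x
  labelArray-appearsOnce partner-closed labels (+ zero)  (x≢0 , _) = ⊥-elim (x≢0 refl)
  labelArray-appearsOnce partner-closed labels (+ suc v) (_ , v<N) =
    labelArray-locate (labels v v<N) v<N (cell-positive (P v) v) λ r w e →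
      let r≡Pw , w≡v = cell-just-positive (P w) r w e
      in  trans r≡Pw (cong P w≡v) , w≡v
  labelArray-appearsOnce partner-closed labels -[1+ v ] (_ , v<N) =
    labelArray-locate (partner-closed (P v) (labels v v<N)) v<N (cell-negative (P v) v) λ r w e →
      let r≡P′w , w≡v = cell-just-negative (P w) r w e
      in  trans r≡P′w (cong (partner ∘ P) w≡v) , w≡v

labelArray-SMR : ∀ M N c (P : ℕ → ℕ) → M * c ≡ N →
  (∀ r → r < M → partner r < M) → LabelsBelow M P N → (∀ r → r < M → Balanced P r N c) →
  IsSMR M N (c + c) 2 (labelArray P) × IsShiftable (labelArray P)
labelArray-SMR M N c P M*c≡N partner-closed labels balanced = smr , shiftable
  where
  bal : (i : Fin M) → Balanced P (toℕ i) N c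
  bal i = balanced (toℕ i) (Finₚ.toℕ<n i)

  p<M : (j : Fin N) → P (toℕ j) < M
  p<M j = labels (toℕ j) (Finₚ.toℕ<n j)

  p′<M : (j : Fin N) → partner (P (toℕ j)) < M
  p′<M j = partner-closed _ (p<M j)

  size≡N : M * (c + c) ℕ./ 2 ≡ N
  size≡N = trans (cong (ℕ._/ 2) (double M c)) (trans (m*n/n≡m (M * c) 2) M*c≡N)
    where
    double : ∀ M c → M * (c + c) ≡ M * c * 2
    double = solve-∀ℕ

  smr : IsSMR M N (c + c) 2 (labelArray P)
  smr = record
    { rowFilled   = λ i → labelArray-rowFilled P i (bal i)
    ; colFilled   = λ j → labelArray-colFilled P j (p<M j) (p′<M j)
    ; entriesInX  = λ i j x e →
        subst (λ K → InX K x) (sym size≡N) (labelArray-entriesInX P i j x e)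
    ; appearsOnce = λ x x∈X →
        labelArray-appearsOnce P partner-closed labels x (subst (λ K → InX K x) size≡N x∈X)
    ; rowSum      = λ i → labelArray-rowSum P i (bal i)
    ; colSum      = λ j → labelArray-colSum P j (p<M j) (p′<M j)
    }

  shiftable : IsShiftable (labelArray P)
  shiftable = record
    { rowBalanced = λ i →
        trans (labelArray-rowPositives P i (bal i)) (sym (labelArray-rowNegatives P i (bal i)))
    ; colBalanced = λ j →
        trans (labelArray-colPositives P j (p<M j)) (sym (labelArray-colNegatives P j (p′<M j)))
    }

_⟨_⟩++_ : (ℕ → ℕ) → ℕ → (ℕ → ℕ) → ℕ → ℕ
(P ⟨ m ⟩++ Q) v = if v <ᵇ m then P v else Q (v ∸ m)

++-prefix : ∀ P Q {m v} → v < m → (P ⟨ m ⟩++ Q) v ≡ P v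
++-prefix P Q {m} {v} v<m with v <ᵇ m | ℕₚ.<⇒<ᵇ v<m
... | true  | _  = refl
... | false | ()

++-suffix : ∀ P Q m v → (P ⟨ m ⟩++ Q) (m + v) ≡ Q v
++-suffix P Q m v with m + v <ᵇ m in eq
... | true  = ⊥-elim (ℕₚ.<⇒≱ (ℕₚ.<ᵇ⇒< (m + v) m (subst T (sym eq) _)) (ℕₚ.m≤m+n m v))
... | false = cong Q (ℕₚ.m+n∸m≡n m v)

Balanced-⟨⟩++ : ∀ {P Q i m n c d} → Balanced P i m c → Balanced Q i n d →
  Balanced (P ⟨ m ⟩++ Q) i (m + n) (c + d)
Balanced-⟨⟩++ {P} {Q} {m = m} {n} front back =
  Balanced-++ m n (Balanced-cong (λ v v<m → ++-prefix P Q v<m) front)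
                  (Balanced-cong (λ v _ → ++-suffix P Q m v) back)

LabelsBelow-⟨⟩++ : ∀ {M P Q m n} → LabelsBelow M P m → LabelsBelow M Q n →
  LabelsBelow M (P ⟨ m ⟩++ Q) (m + n)
LabelsBelow-⟨⟩++ {M} {P} {Q} {m} {n} P<M Q<M v v<m+n with v <? m
... | yes v<m = subst (_< M) (sym (++-prefix P Q v<m)) (P<M v v<m)
... | no  v≮m = subst (λ w → (P ⟨ m ⟩++ Q) w < M) m+u≡v
                  (subst (_< M) (sym (++-suffix P Q m u)) (Q<M u u<n))
  where
  u = v ∸ m
  m+u≡v : m + u ≡ v
  m+u≡v = ℕₚ.m+[n∸m]≡n (ℕₚ.≮⇒≥ v≮m)
  u<n : u < n
  u<n = ℕₚ.+-cancelˡ-< m u n (subst (_< m + n) (sym m+u≡v) v<m+n)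

LabelsBelow-mono : ∀ {M M′ P n} → M ≤ M′ → LabelsBelow M P n → LabelsBelow M′ P n
LabelsBelow-mono M≤M′ P<M v v<n = ℕₚ.≤-trans (P<M v v<n) M≤M′

fromList : List ℕ → ℕ → ℕ
fromList []       _       = 0
fromList (x ∷ xs) zero    = x
fromList (x ∷ xs) (suc v) = fromList xs v

LabelsBelow-fromList : ∀ {M xs} → All (_< M) xs → LabelsBelow M (fromList xs) (length xs)
LabelsBelow-fromList (x<M ∷ _)    zero    _         = x<M
LabelsBelow-fromList (_   ∷ xs<M) (suc v) (s≤s v<n) = LabelsBelow-fromList xs<M v v<n

baseLabels : List ℕ
baseLabels = 0 ∷ 1 ∷ 2 ∷ 1 ∷ 3 ∷ 0 ∷ 3 ∷ 0 ∷ 1 ∷ 2 ∷ 2 ∷ 3 ∷ []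

growthLabels : List ℕ
growthLabels = 0 ∷ 1 ∷ 1 ∷ 0 ∷ 2 ∷ 3 ∷ 3 ∷ 2 ∷ []

baseLabels-balanced : ∀ i → i < 4 → Balanced (fromList baseLabels) i 12 3
baseLabels-balanced 0 _ = record { positives = refl ; negatives = refl ; signedSum = refl }
baseLabels-balanced 1 _ = record { positives = refl ; negatives = refl ; signedSum = refl }
baseLabels-balanced 2 _ = record { positives = refl ; negatives = refl ; signedSum = refl }
baseLabels-balanced 3 _ = record { positives = refl ; negatives = refl ; signedSum = refl }
baseLabels-balanced (suc (suc (suc (suc _)))) (s≤s (s≤s (s≤s (s≤s ()))))

growthLabels-balanced : ∀ i → i < 4 → Balanced (fromList growthLabels) i 8 2
growthLabels-balanced 0 _ = record { positives = refl ; negatives = refl ; signedSum = refl }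
growthLabels-balanced 1 _ = record { positives = refl ; negatives = refl ; signedSum = refl }
growthLabels-balanced 2 _ = record { positives = refl ; negatives = refl ; signedSum = refl }
growthLabels-balanced 3 _ = record { positives = refl ; negatives = refl ; signedSum = refl }
growthLabels-balanced (suc (suc (suc (suc _)))) (s≤s (s≤s (s≤s (s≤s ()))))

block : ℕ → ℕ → ℕ
block zero    = fromList baseLabels
block (suc k) = fromList growthLabels ⟨ 8 ⟩++ block k

block-balanced : ∀ k i → i < 4 → Balanced (block k) i (k * 8 + 12) (k * 2 + 3)
block-balanced zero    i i<4 = baseLabels-balanced i i<4
block-balanced (suc k) i i<4 = Balanced-⟨⟩++ (growthLabels-balanced i i<4) (block-balanced k i i<4)

block-labels : ∀ k → LabelsBelow 4 (block k) (k * 8 + 12)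
block-labels zero    = LabelsBelow-fromList (toWitness {a? = all? (_<? 4) baseLabels} _)
block-labels (suc k) =
  LabelsBelow-⟨⟩++ (LabelsBelow-fromList (toWitness {a? = all? (_<? 4) growthLabels} _))
                   (block-labels k)

stack : ℕ → (ℕ → ℕ) → ℕ → ℕ → ℕ
stack n Q zero    = λ _ → 0
stack n Q (suc b) = Q ⟨ n ⟩++ (λ v → 4 + stack n Q b v)

stack-labels : ∀ {n Q} → LabelsBelow 4 Q n → ∀ b → LabelsBelow (b * 4) (stack n Q b) (b * n)
stack-labels Q<4 zero    v ()
stack-labels Q<4 (suc b) =
  LabelsBelow-⟨⟩++ (LabelsBelow-mono (ℕₚ.m≤m+n 4 (b * 4)) Q<4)
                   (λ v v<bn → ℕₚ.+-monoʳ-< 4 (stack-labels Q<4 b v v<bn))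

stack-balanced : ∀ {n Q c} → LabelsBelow 4 Q n → (∀ i → i < 4 → Balanced Q i n c) →
  ∀ b i → i < b * 4 → Balanced (stack n Q b) i (b * n) c
stack-balanced {n} {Q} {c} Q<4 Q-bal (suc b) = rowOf
  where
  lowRow : ∀ {i} → i < 4 → Balanced (stack n Q (suc b)) i (n + b * n) c
  lowRow {i} i<4 = subst (Balanced (stack n Q (suc b)) i (n + b * n)) (ℕₚ.+-identityʳ c)
    (Balanced-⟨⟩++ (Q-bal i i<4)
      (Balanced-absent (λ v _ → ℕₚ.>⇒≢ (ℕₚ.<-≤-trans i<4 (ℕₚ.m≤m+n 4 (stack n Q b v))))
                       (λ v _ → ℕₚ.>⇒≢ (ℕₚ.<-≤-trans (partner-< 2 i i<4)
                                                      (ℕₚ.m≤m+n 4 (stack n Q b v))))))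
  rowOf : ∀ i → i < suc b * 4 → Balanced (stack n Q (suc b)) i (n + b * n) c
  rowOf 0 _ = lowRow (s≤s z≤n)
  rowOf 1 _ = lowRow (s≤s (s≤s z≤n))
  rowOf 2 _ = lowRow (s≤s (s≤s (s≤s z≤n)))
  rowOf 3 _ = lowRow (s≤s (s≤s (s≤s (s≤s z≤n))))
  rowOf (suc (suc (suc (suc i)))) (s≤s (s≤s (s≤s (s≤s i<4b)))) =
    Balanced-⟨⟩++
      (Balanced-absent (λ v v<n → ℕₚ.<⇒≢ (ℕₚ.<-≤-trans (Q<4 v v<n) (ℕₚ.m≤m+n 4 i)))
                       (λ v v<n → ℕₚ.<⇒≢ (ℕₚ.<-≤-trans (Q<4 v v<n) (ℕₚ.m≤m+n 4 (partner i)))))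
      (Balanced-+2 (Balanced-+2 (stack-balanced Q<4 Q-bal b i i<4b)))

ShiftableSMR : ℕ → ℕ → ℕ → ℕ → Set
ShiftableSMR m n r s = Σ (PArray m n) λ A → IsSMR m n r s A × IsShiftable A

ShiftableSMR-cong : ∀ {m m′ n n′ r r′ s} → m ≡ m′ → n ≡ n′ → r ≡ r′ →
  ShiftableSMR m n r s → ShiftableSMR m′ n′ r′ s
ShiftableSMR-cong refl refl refl smr = smr

stack-shiftableSMR : ∀ {n c Q} → n ≡ c * 4 → LabelsBelow 4 Q n →
  (∀ i → i < 4 → Balanced Q i n c) → ∀ b → ShiftableSMR (b * 4) (b * n) (c + c) 2
stack-shiftableSMR {n} {c} {Q} n≡c*4 Q<4 Q-bal b =
  labelArray (stack n Q b) ,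
  labelArray-SMR (b * 4) (b * n) c (stack n Q b) M*c≡N partner-closed
                 (stack-labels Q<4 b) (stack-balanced Q<4 Q-bal b)
  where
  M*c≡N : b * 4 * c ≡ b * n
  M*c≡N = trans (arithmetic b c) (cong (b *_) (sym n≡c*4))
    where
    arithmetic : ∀ b c → b * 4 * c ≡ b * (c * 4)
    arithmetic = solve-∀ℕ
  partner-closed : ∀ r → r < b * 4 → partner r < b * 4
  partner-closed r r<M =
    subst (partner r <_) (ℕₚ.*-assoc b 2 2)
          (partner-< (b * 2) r (subst (r <_) (sym (ℕₚ.*-assoc b 2 2)) r<M))

lemma12 : (a b : ℕ) → a ≥ 1 → b ≥ 1 →
    Σ (PArray (4 * b) (2 * b * (4 * a + 2))) λ A →
      IsSMR (4 * b) (2 * b * (4 * a + 2)) (4 * a + 2) 2 A × IsShiftable A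
lemma12 zero    b () _
lemma12 (suc k) b _ _ =
  ShiftableSMR-cong (ℕₚ.*-comm b 4) (columns k b) (rowLength k)
    (stack-shiftableSMR (blockLength k) (block-labels k) (block-balanced k) b)
  where
  blockLength : ∀ k → k * 8 + 12 ≡ (k * 2 + 3) * 4
  blockLength = solve-∀ℕ
  columns : ∀ k b → b * (k * 8 + 12) ≡ 2 * b * (4 * suc k + 2)
  columns = solve-∀ℕ
  rowLength : ∀ k → (k * 2 + 3) + (k * 2 + 3) ≡ 4 * suc k + 2
  rowLength = solve-∀ℕ
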